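{- For $n>0$ and integers $i,j\ge 0$ with $0\le i+j<n$, \[ K(n,i,j)=(i+j+1)\big[K(n-1,i,j)+K(n-1,i,j-1)\big]+(n-i-j)\big[K(n-1,i-1,j)+K(n-1,i-1,j-1)\big]. \] Moreover, if in addition $j>0$, then \[ j\,K(n,i,j)=(n-i-j)\,K(n,i,j-1)+(i+1)\,K(n,i+1,j-1). \]
   Context: A segmented permutation of size $n$ is a permutation $\sigma=\sigma_1\cdots\sigma_n$ of $\{1,\dots,n\}$, written as a word, together with a choice, for each position $i\in\{1,\dots,n-1\}$, of whether or not a bar is placed between $\sigma_i$ and $\sigma_{i+1}$. $SP_n$ is the set of these ($SP_0$ consists of the empty permutation only). A position $i<n$ is a segmentation if there is a bar between $\sigma_i$ and $\sigma_{i+1}$, and a descent if it is not a segmentation and $\sigma_i>\sigma_{i+1}$. $\operatorname{des}(\sigma)$, $\operatorname{seg}(\sigma)$ are the numbers of descents and of segmentations. $K(n,i,j)=\#\{\sigma\in SP_n\mid \operatorname{des}(\sigma)=i,\ \operatorname{seg}(\sigma)=j\}$, with $K(n,i,j)=0$ whenever $i<0$ or $j<0$. -}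

module Defs where

open import Data.Bool using (Bool; true; false; if_then_else_; _∧_; not)
open import Data.Nat using (ℕ; zero; suc; _+_; _∸_; _<ᵇ_; _≡ᵇ_)
open import Data.Integer using (ℤ; +_; -[1+_])
open import Data.List using (List; []; _∷_; map; concatMap; filter; length; upTo)
open import Data.Bool.ListAction using (any)
open import Data.Product using (_×_; _,_)
open import Relation.Binary.PropositionalEquality using (_≡_)
open import Relation.Nullary.Decidable using (Dec; yes; no)
open import Data.Bool using (T)
open import Data.Bool.Properties using (T?)

words : {A : Set} → ℕ → List A → List (List A)
words zero    xs = [] ∷ []
words (suc k) xs = concatMap (λ x → map (x ∷_) (words k xs)) xs

elem : ℕ → List ℕ → Bool
elem x ys = any (λ y → x ≡ᵇ y) ys

noDup : List ℕ → Bool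
noDup []       = true
noDup (x ∷ xs) = not (elem x xs) ∧ noDup xs

letters : ℕ → List ℕ
letters n = map suc (upTo n)

perms : ℕ → List (List ℕ)
perms n = filter (λ w → T? (noDup w)) (words n (letters n))

-- A segmented permutation: a permutation word σ₁⋯σₙ together with a
-- list of n-1 booleans; the i-th boolean (i = 1,…,n-1) is true iff there
-- is a bar between σᵢ and σᵢ₊₁.
SPerm : Set
SPerm = List ℕ × List Bool

SP : ℕ → List SPerm
SP n = concatMap (λ w → map (λ b → (w , b)) (words (n ∸ 1) (true ∷ false ∷ []))) (perms n)

desW : List ℕ → List Bool → ℕ
desW (a ∷ b ∷ w) (bar ∷ bs) = (if bar then 0 else (if b <ᵇ a then 1 else 0)) + desW (b ∷ w) bs
desW _ _ = 0

segB : List Bool → ℕ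
segB []           = 0
segB (true ∷ bs)  = suc (segB bs)
segB (false ∷ bs) = segB bs

des : SPerm → ℕ
des (w , bs) = desW w bs

seg : SPerm → ℕ
seg (w , bs) = segB bs

K : ℕ → ℕ → ℕ → ℕ
K n i j = length (filter (λ σ → T? ((des σ ≡ᵇ i) ∧ (seg σ ≡ᵇ j))) (SP n))

Kℤ : ℕ → ℤ → ℤ → ℕ
Kℤ n (+ i) (+ j) = K n i j
Kℤ n _ _ = 0

module Submission where

-- For a permutation word w of length k + 1, its bar table
-- barTable k w i j counts the bar patterns (k booleans) giving w exactly
-- i descents and j segmentations, and K n is the sum of the bar tables of
-- all permutations of size n (K-as-sum).  Both identities are proved for
-- one word at a time and then summed over all permutations.
--   * Prepending a letter a to b ∷ w acts on bar tables by the linear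
--     operator extend (b <ᵇ a) (barTable-cons): the new gap is barred or
--     not, and unbarred it is a descent iff a > b.
--   * The second identity (SegRecurrence) holds for the bar table of any
--     word: it holds for one letter and is preserved by extend.
--   * Permutations of size n + 1 are the insertions of n + 1 into those of
--     size n (sumBy-perms-suc).  For a word w with letters below m, the bar
--     tables of the insertions of m into w add up to the right-hand side of
--     the first identity applied to the bar table of w
--     (insertion-recurrence), by induction on w; the induction step is the
--     operator identity recurrence-extend.

open import Defs
open import Data.Bool using (Bool; true; false; if_then_else_; _∧_; _∨_; not)
open import Data.Bool.Properties using (T?; T-≡; ∧-zeroʳ)
open import Data.Nat using (ℕ; zero; suc; _+_; _*_; _∸_; _≤_; _<_; _≤?_; _≡ᵇ_; _<ᵇ_; z≤n; s≤s)
open import Data.Nat.Properties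
open import Algebra.Properties.CommutativeSemigroup +-commutativeSemigroup
  using () renaming (interchange to +-interchange; x∙yz≈y∙xz to +-exchange)
open import Data.Nat.Tactic.RingSolver using (solve-∀)
open import Data.List using (List; []; _∷_; [_]; _++_; map; concatMap; filter; length; upTo)
open import Data.List.Properties
  using (length-map; length-++; length-upTo; upTo-∷ʳ; map-++; filter-++; length-filter; ++-identityʳ)
open import Data.List.Membership.Propositional using (_∈_)
open import Data.List.Relation.Unary.Any using (here; there)
open import Data.List.Relation.Unary.All as All using (All; []; _∷_)
open import Data.List.Relation.Unary.All.Properties using (map⁺; concat⁺; filter⁺; all-upTo)
open import Data.Product using (_×_; _,_)
open import Data.Empty using (⊥-elim)
open import Function using (_∘_)
open import Function.Bundles using (Equivalence)
open import Relation.Binary.PropositionalEquality hiding ([_])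
open import Relation.Nullary using (yes; no)

private
  variable
    A B : Set

infixr 5 _∙_
_∙_ : {x y z : A} → x ≡ y → y ≡ z → x ≡ z
_∙_ = trans

select : (A → Bool) → List A → List A
select p = filter (T? ∘ p)

count : (A → Bool) → List A → ℕ
count p xs = length (select p xs)

sumBy : (A → ℕ) → List A → ℕ
sumBy f []       = 0
sumBy f (x ∷ xs) = f x + sumBy f xs

select-map : (p : B → Bool) (f : A → B) (xs : List A) →
  select p (map f xs) ≡ map f (select (p ∘ f) xs)
select-map p f [] = refl
select-map p f (x ∷ xs) with p (f x)
... | true  = cong (f x ∷_) (select-map p f xs)
... | false = select-map p f xs

select-∧ : (p q : A → Bool) (xs : List A) → select (λ x → p x ∧ q x) xs ≡ select q (select p xs)
select-∧ p q [] = refl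
select-∧ p q (x ∷ xs) with p x
... | false = select-∧ p q xs
... | true with q x
...   | true  = cong (x ∷_) (select-∧ p q xs)
...   | false = select-∧ p q xs

select-none : (p : A → Bool) (xs : List A) → All (λ x → p x ≡ false) xs → select p xs ≡ []
select-none p [] [] = refl
select-none p (x ∷ xs) (px ∷ pxs) rewrite px = select-none p xs pxs

select-concatMap : (p : B → Bool) (g : A → List B) (xs : List A) →
  select p (concatMap g xs) ≡ concatMap (select p ∘ g) xs
select-concatMap p g [] = refl
select-concatMap p g (x ∷ xs) =
  filter-++ (T? ∘ p) (g x) (concatMap g xs) ∙ cong (select p (g x) ++_) (select-concatMap p g xs)

concatMap-cong : {f g : A → List B} → (∀ x → f x ≡ g x) → (xs : List A) → concatMap f xs ≡ concatMap g xs
concatMap-cong e [] = refl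
concatMap-cong e (x ∷ xs) = cong₂ _++_ (e x) (concatMap-cong e xs)

concatMap-select : (g : A → List B) (q : A → Bool) (xs : List A) →
  concatMap g (select q xs) ≡ concatMap (λ y → if q y then g y else []) xs
concatMap-select g q [] = refl
concatMap-select g q (x ∷ xs) with q x
... | true  = cong (g x ++_) (concatMap-select g q xs)
... | false = concatMap-select g q xs

concatMap-empty : {g : A → List B} (xs : List A) → (∀ {x} → x ∈ xs → g x ≡ []) → concatMap g xs ≡ []
concatMap-empty [] _ = refl
concatMap-empty (x ∷ xs) empty = cong₂ _++_ (empty (here refl)) (concatMap-empty xs (empty ∘ there))

All-concatMap : {P : B → Set} {g : A → List B} (xs : List A) →
  All (λ x → All P (g x)) xs → All P (concatMap g xs)
All-concatMap xs allP = concat⁺ (map⁺ allP)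

sumBy-++ : (f : A → ℕ) (xs ys : List A) → sumBy f (xs ++ ys) ≡ sumBy f xs + sumBy f ys
sumBy-++ f [] ys = refl
sumBy-++ f (x ∷ xs) ys = cong (f x +_) (sumBy-++ f xs ys) ∙ sym (+-assoc (f x) _ _)

sumBy-map : (f : B → ℕ) (g : A → B) (xs : List A) → sumBy f (map g xs) ≡ sumBy (f ∘ g) xs
sumBy-map f g [] = refl
sumBy-map f g (x ∷ xs) = cong (f (g x) +_) (sumBy-map f g xs)

sumBy-concatMap : (f : B → ℕ) (g : A → List B) (xs : List A) →
  sumBy f (concatMap g xs) ≡ sumBy (sumBy f ∘ g) xs
sumBy-concatMap f g [] = refl
sumBy-concatMap f g (x ∷ xs) =
  sumBy-++ f (g x) (concatMap g xs) ∙ cong (sumBy f (g x) +_) (sumBy-concatMap f g xs)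

sumBy-congᴬ : {f g : A → ℕ} (xs : List A) → All (λ x → f x ≡ g x) xs → sumBy f xs ≡ sumBy g xs
sumBy-congᴬ [] [] = refl
sumBy-congᴬ (x ∷ xs) (e ∷ es) = cong₂ _+_ e (sumBy-congᴬ xs es)

sumBy-cong : {f g : A → ℕ} → (∀ x → f x ≡ g x) → (xs : List A) → sumBy f xs ≡ sumBy g xs
sumBy-cong e xs = sumBy-congᴬ xs (All.tabulate λ {x} _ → e x)

sumBy-+ : (f g : A → ℕ) (xs : List A) → sumBy (λ x → f x + g x) xs ≡ sumBy f xs + sumBy g xs
sumBy-+ f g [] = refl
sumBy-+ f g (x ∷ xs) = cong (f x + g x +_) (sumBy-+ f g xs) ∙ +-interchange (f x) (g x) (sumBy f xs) (sumBy g xs)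

sumBy-* : (a : ℕ) (f : A → ℕ) (xs : List A) → sumBy (λ x → a * f x) xs ≡ a * sumBy f xs
sumBy-* a f [] = sym (*-zeroʳ a)
sumBy-* a f (x ∷ xs) = cong (a * f x +_) (sumBy-* a f xs) ∙ sym (*-distribˡ-+ a (f x) (sumBy f xs))

sumBy-zero : (xs : List A) → sumBy (λ _ → 0) xs ≡ 0
sumBy-zero [] = refl
sumBy-zero (x ∷ xs) = sumBy-zero xs

count-++ : (p : A → Bool) (xs ys : List A) → count p (xs ++ ys) ≡ count p xs + count p ys
count-++ p xs ys = cong length (filter-++ (T? ∘ p) xs ys) ∙ length-++ (select p xs)

count-map : (p : B → Bool) (f : A → B) (xs : List A) → count p (map f xs) ≡ count (p ∘ f) xs
count-map p f xs = cong length (select-map p f xs) ∙ length-map f (select (p ∘ f) xs)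

count-concatMap : (p : B → Bool) (g : A → List B) (xs : List A) →
  count p (concatMap g xs) ≡ sumBy (count p ∘ g) xs
count-concatMap p g xs = cong length (select-concatMap p g xs) ∙ length-concatMap xs
  where
  length-concatMap : (ys : List _) → length (concatMap (select p ∘ g) ys) ≡ sumBy (count p ∘ g) ys
  length-concatMap [] = refl
  length-concatMap (y ∷ ys) = length-++ (select p (g y)) ∙ cong (count p (g y) +_) (length-concatMap ys)

words-length : (k : ℕ) (L : List A) → All (λ w → length w ≡ k) (words k L)
words-length zero L = refl ∷ []
words-length (suc k) L =
  All-concatMap L (All.tabulate λ _ → map⁺ (All.map (cong suc) (words-length k L)))

words-over : {P : A → Set} (k : ℕ) (L : List A) → All P L → All (All P) (words k L)
words-over zero L allP = [] ∷ []
words-over (suc k) L allP =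
  All-concatMap L (All.map (λ px → map⁺ (All.map (px ∷_) (words-over k L allP))) allP)

injWords : ℕ → List ℕ → List (List ℕ)
injWords k L = select noDup (words k L)

remove : ℕ → List ℕ → List ℕ
remove y = select (λ z → not (y ≡ᵇ z))

≡ᵇ-refl : ∀ y → (y ≡ᵇ y) ≡ true
≡ᵇ-refl zero    = refl
≡ᵇ-refl (suc y) = ≡ᵇ-refl y

≢⇒≡ᵇ-false : ∀ {x y} → x ≢ y → (x ≡ᵇ y) ≡ false
≢⇒≡ᵇ-false {x} {y} x≢y with x ≡ᵇ y in eq
... | false = refl
... | true  = ⊥-elim (x≢y (≡ᵇ⇒≡ x y (Equivalence.from T-≡ eq)))

words-avoiding : ∀ x k L → select (λ w → not (elem x w)) (words k L) ≡ words k (remove x L)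
words-avoiding x zero L = refl
words-avoiding x (suc k) L =
  select-concatMap _ (λ y → map (y ∷_) (words k L)) L
  ∙ concatMap-cong starting-with L
  ∙ sym (concatMap-select (λ y → map (y ∷_) (words k (remove x L))) (λ z → not (x ≡ᵇ z)) L)
  where
  avoiding-tail : ∀ y → map (y ∷_) (select (λ w → not ((x ≡ᵇ y) ∨ elem x w)) (words k L))
                        ≡ (if not (x ≡ᵇ y) then map (y ∷_) (words k (remove x L)) else [])
  avoiding-tail y with x ≡ᵇ y
  ... | true  = cong (map (y ∷_)) (select-none _ (words k L) (All.tabulate λ _ → refl))
  ... | false = cong (map (y ∷_)) (words-avoiding x k L)
  starting-with : ∀ y → select (λ w → not (elem x w)) (map (y ∷_) (words k L))
                        ≡ (if not (x ≡ᵇ y) then map (y ∷_) (words k (remove x L)) else [])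
  starting-with y = select-map (λ w → not (elem x w)) (y ∷_) (words k L) ∙ avoiding-tail y

injWords-suc : ∀ k L → injWords (suc k) L ≡ concatMap (λ y → map (y ∷_) (injWords k (remove y L))) L
injWords-suc k L = select-concatMap noDup (λ y → map (y ∷_) (words k L)) L ∙ concatMap-cong starting-with L
  where
  starting-with : ∀ y → select noDup (map (y ∷_) (words k L)) ≡ map (y ∷_) (injWords k (remove y L))
  starting-with y = select-map noDup (y ∷_) (words k L)
    ∙ cong (map (y ∷_)) (select-∧ (λ w → not (elem y w)) noDup (words k L)
                         ∙ cong (select noDup) (words-avoiding y k L))

sumBy-injWords-suc : ∀ (f : List ℕ → ℕ) k L →
  sumBy f (injWords (suc k) L) ≡ sumBy (λ y → sumBy (f ∘ (y ∷_)) (injWords k (remove y L))) L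
sumBy-injWords-suc f k L =
  cong (sumBy f) (injWords-suc k L) ∙ sumBy-concatMap f _ L
  ∙ sumBy-cong (λ y → sumBy-map f (y ∷_) (injWords k (remove y L))) L

remove-shorter : ∀ y L → y ∈ L → length (remove y L) < length L
remove-shorter y (y ∷ L) (here refl) rewrite ≡ᵇ-refl y = s≤s (length-filter (T? ∘ (λ z → not (y ≡ᵇ z))) L)
remove-shorter y (z ∷ L) (there y∈L) with not (y ≡ᵇ z)
... | true  = s≤s (remove-shorter y L y∈L)
... | false = m<n⇒m<1+n (remove-shorter y L y∈L)

injWords-empty : ∀ k L → length L < k → injWords k L ≡ []
injWords-empty (suc k) L lt = injWords-suc k L ∙ concatMap-empty L λ {y} y∈L →
  cong (map (y ∷_)) (injWords-empty k (remove y L) (<-≤-trans (remove-shorter y L y∈L) (≤-pred lt)))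

remove-snoc : ∀ y L m → y ≢ m → remove y (L ++ [ m ]) ≡ remove y L ++ [ m ]
remove-snoc y L m y≢m rewrite filter-++ (T? ∘ (λ z → not (y ≡ᵇ z))) L [ m ] | ≢⇒≡ᵇ-false y≢m = refl

remove-absent : ∀ m L → All (_≢ m) L → remove m L ≡ L
remove-absent m [] [] = refl
remove-absent m (y ∷ L) (y≢m ∷ L≢m) rewrite ≢⇒≡ᵇ-false (y≢m ∘ sym) = cong (y ∷_) (remove-absent m L L≢m)

remove-snoc-self : ∀ m L → All (_≢ m) L → remove m (L ++ [ m ]) ≡ L
remove-snoc-self m L L≢m
  rewrite filter-++ (T? ∘ (λ z → not (m ≡ᵇ z))) L [ m ] | ≡ᵇ-refl m | remove-absent m L L≢m = ++-identityʳ L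

insertions : ℕ → List ℕ → List (List ℕ)
insertions m []      = [ m ] ∷ []
insertions m (a ∷ w) = (m ∷ a ∷ w) ∷ map (a ∷_) (insertions m w)

-- Adjoining a new letter m to the alphabet: an injective word of length
-- k + 1 either avoids m or is an insertion of m into an injective word of
-- length k over the old alphabet.
sumBy-injWords-snoc : ∀ k L m → All (_≢ m) L → ∀ (f : List ℕ → ℕ) →
  sumBy f (injWords (suc k) (L ++ [ m ]))
    ≡ sumBy f (injWords (suc k) L) + sumBy (λ w → sumBy f (insertions m w)) (injWords k L)
sumBy-injWords-snoc zero L m L≢m f =
  sumBy-injWords-suc f zero (L ++ [ m ]) ∙ sumBy-++ _ L [ m ] ∙ cong (_+ _) (sym (sumBy-injWords-suc f zero L))
sumBy-injWords-snoc (suc k) L m L≢m f = begin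
  sumBy f (injWords (suc (suc k)) (L ++ [ m ]))
    ≡⟨ sumBy-injWords-suc f (suc k) (L ++ [ m ]) ∙ sumBy-++ _ L [ m ] ⟩
  sumBy (λ y → sumBy (f ∘ (y ∷_)) (injWords (suc k) (remove y (L ++ [ m ])))) L
    + (sumBy (f ∘ (m ∷_)) (injWords (suc k) (remove m (L ++ [ m ]))) + 0)
    ≡⟨ cong₂ _+_ (sumBy-congᴬ L (All.map old-first L≢m) ∙ sumBy-+ avoiding insert L) (+-identityʳ _ ∙ m-first) ⟩
  (sumBy avoiding L + sumBy insert L) + sumBy m-then L
    ≡⟨ +-assoc (sumBy avoiding L) _ _ ∙ cong (sumBy avoiding L +_) (+-comm (sumBy insert L) _) ⟩
  sumBy avoiding L + (sumBy m-then L + sumBy insert L)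
    ≡⟨ cong₂ _+_ (sym (sumBy-injWords-suc f (suc k) L)) (sym (sumBy-+ m-then insert L) ∙ sumBy-cong insertions-after L) ⟩
  sumBy f (injWords (suc (suc k)) L) + sumBy (λ y → sumBy (g ∘ (y ∷_)) (injWords k (remove y L))) L
    ≡⟨ cong (sumBy f (injWords (suc (suc k)) L) +_) (sym (sumBy-injWords-suc g k L)) ⟩
  sumBy f (injWords (suc (suc k)) L) + sumBy g (injWords (suc k) L) ∎
  where
  open ≡-Reasoning
  g = λ w → sumBy f (insertions m w)
  -- Words with an old first letter y: the rest avoids m, or is an insertion
  -- of m (by induction on k).  Words with first letter m: then comes some y.
  avoiding = λ y → sumBy (f ∘ (y ∷_)) (injWords (suc k) (remove y L))
  insert   = λ y → sumBy (λ w → sumBy (f ∘ (y ∷_)) (insertions m w)) (injWords k (remove y L))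
  m-then   = λ y → sumBy (f ∘ (m ∷_) ∘ (y ∷_)) (injWords k (remove y L))
  old-first : ∀ {y} → y ≢ m →
    sumBy (f ∘ (y ∷_)) (injWords (suc k) (remove y (L ++ [ m ]))) ≡ avoiding y + insert y
  old-first {y} y≢m =
    cong (λ X → sumBy (f ∘ (y ∷_)) (injWords (suc k) X)) (remove-snoc y L m y≢m)
    ∙ sumBy-injWords-snoc k (remove y L) m (filter⁺ (T? ∘ (λ z → not (y ≡ᵇ z))) L≢m) (f ∘ (y ∷_))
  m-first : sumBy (f ∘ (m ∷_)) (injWords (suc k) (remove m (L ++ [ m ]))) ≡ sumBy m-then L
  m-first = cong (λ X → sumBy (f ∘ (m ∷_)) (injWords (suc k) X)) (remove-snoc-self m L L≢m)
          ∙ sumBy-injWords-suc (f ∘ (m ∷_)) k L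
  -- Inserting m into y ∷ u: in front of y, or into u.
  insertions-after : ∀ y → m-then y + insert y ≡ sumBy (g ∘ (y ∷_)) (injWords k (remove y L))
  insertions-after y =
    sym (sumBy-+ (λ u → f (m ∷ y ∷ u)) (λ u → sumBy (f ∘ (y ∷_)) (insertions m u)) (injWords k (remove y L)))
    ∙ sumBy-cong (λ u → cong (f (m ∷ y ∷ u) +_) (sym (sumBy-map f (y ∷_) (insertions m u)))) (injWords k (remove y L))

letters-snoc : ∀ n → letters (suc n) ≡ letters n ++ [ suc n ]
letters-snoc n = cong (map suc) (sym (upTo-∷ʳ n)) ∙ map-++ suc (upTo n) [ n ]

letters-length : ∀ n → length (letters n) ≡ n
letters-length n = length-map suc (upTo n) ∙ length-upTo n

letters-bounded : ∀ n → All (_< suc n) (letters n)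
letters-bounded n = map⁺ (All.map s≤s (all-upTo n))

sumBy-perms-suc : ∀ n (f : List ℕ → ℕ) →
  sumBy f (perms (suc n)) ≡ sumBy (λ w → sumBy f (insertions (suc n) w)) (perms n)
sumBy-perms-suc n f =
  cong (λ X → sumBy f (injWords (suc n) X)) (letters-snoc n)
  ∙ sumBy-injWords-snoc n (letters n) (suc n) (All.map <⇒≢ (letters-bounded n)) f
  ∙ cong (λ X → sumBy f X + sumBy (λ w → sumBy f (insertions (suc n) w)) (perms n))
         (injWords-empty (suc n) (letters n) (≤-reflexive (cong suc (letters-length n))))

perms-length : ∀ n → All (λ w → length w ≡ n) (perms n)
perms-length n = filter⁺ (T? ∘ noDup) (words-length n (letters n))

perms-bounded : ∀ n → All (All (_< suc n)) (perms n)
perms-bounded n = filter⁺ (T? ∘ noDup) (words-over n (letters n) (letters-bounded n))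

-- A table of counts indexed by the numbers i of descents and j of segmentations.
Table : Set
Table = ℕ → ℕ → ℕ

infix 4 _≐_
_≐_ : Table → Table → Set
c ≐ d = ∀ i j → c i j ≡ d i j

infixl 6 _⊕_
_⊕_ : Table → Table → Table
(c ⊕ d) i j = c i j + d i j

shiftDes : Table → Table
shiftDes c zero    j = 0
shiftDes c (suc i) j = c i j

shiftSeg : Table → Table
shiftSeg c i zero    = 0
shiftSeg c i (suc j) = c i j

-- The effect of one more gap: either it is barred (shiftSeg) or not, and
-- then it is a descent (shiftDes) exactly when desc holds.
extend : Bool → Table → Table
extend desc c i j = (if desc then shiftDes c i j else c i j) + shiftSeg c i j

-- The right-hand side of the first identity, applied to a table c of size N - 1.
recurrence : ℕ → Table → Table
recurrence N c i j =
  (i + j + 1) * (c i j + shiftSeg c i j) + (N ∸ i ∸ j) * (shiftDes c i j + shiftDes (shiftSeg c) i j)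

-- The second identity, for a table of size k + 1.
SegRecurrence : Table → ℕ → Set
SegRecurrence c k = ∀ i j → j * c i j ≡ (suc k ∸ i ∸ j) * shiftSeg c i j + suc i * shiftSeg c (suc i) j

Bounded : Table → ℕ → Set
Bounded c k = ∀ i j → k < i + j → c i j ≡ 0

shiftDes-cong : ∀ {c d} → c ≐ d → shiftDes c ≐ shiftDes d
shiftDes-cong e zero    j = refl
shiftDes-cong e (suc i) j = e i j

shiftSeg-cong : ∀ {c d} → c ≐ d → shiftSeg c ≐ shiftSeg d
shiftSeg-cong e i zero    = refl
shiftSeg-cong e i (suc j) = e i j

extend-cong : ∀ g {c d} → c ≐ d → extend g c ≐ extend g d
extend-cong true  e i j = cong₂ _+_ (shiftDes-cong e i j) (shiftSeg-cong e i j)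
extend-cong false e i j = cong₂ _+_ (e i j) (shiftSeg-cong e i j)

recurrence-cong : ∀ N {c d} → c ≐ d → recurrence N c ≐ recurrence N d
recurrence-cong N e i j =
  cong₂ _+_ (cong ((i + j + 1) *_) (cong₂ _+_ (e i j) (shiftSeg-cong e i j)))
            (cong ((N ∸ i ∸ j) *_) (cong₂ _+_ (shiftDes-cong e i j) (shiftDes-cong (shiftSeg-cong e) i j)))

SegRecurrence-cong : ∀ {c d} k → c ≐ d → SegRecurrence c k → SegRecurrence d k
SegRecurrence-cong k e rec i j =
  cong (j *_) (sym (e i j)) ∙ rec i j
  ∙ cong₂ _+_ (cong ((suc k ∸ i ∸ j) *_) (shiftSeg-cong e i j)) (cong (suc i *_) (shiftSeg-cong e (suc i) j))

bounded-weaken : ∀ {c} k → Bounded c k → Bounded c (suc k)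
bounded-weaken k bd i j lt = bd i j (<-trans (n<1+n k) lt)

shiftDes-bounded : ∀ {c} k → Bounded c k → Bounded (shiftDes c) (suc k)
shiftDes-bounded k bd zero    j lt = refl
shiftDes-bounded k bd (suc i) j lt = bd i j (≤-pred lt)

shiftSeg-bounded : ∀ {c} k → Bounded c k → Bounded (shiftSeg c) (suc k)
shiftSeg-bounded k bd i zero    lt = refl
shiftSeg-bounded k bd i (suc j) lt = bd i j (≤-pred (subst (suc k <_) (+-suc i j) lt))

extend-bounded : ∀ g {c} k → Bounded c k → Bounded (extend g c) (suc k)
extend-bounded true k bd i j lt
  rewrite shiftDes-bounded k bd i j lt | shiftSeg-bounded k bd i j lt = refl
extend-bounded false k bd i j lt
  rewrite bounded-weaken k bd i j lt | shiftSeg-bounded k bd i j lt = refl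

factor-suc : ∀ N i j → i + j ≤ N → suc N ∸ i ∸ j ≡ suc (N ∸ i ∸ j)
factor-suc N i j le = ∸-+-assoc (suc N) i j ∙ +-∸-assoc 1 le ∙ cong suc (sym (∸-+-assoc N i j))

factor-shift : ∀ N i j → suc N ∸ i ∸ suc j ≡ N ∸ i ∸ j
factor-shift N i j = ∸-+-assoc (suc N) i (suc j) ∙ cong (suc N ∸_) (+-suc i j) ∙ sym (∸-+-assoc N i j)

factor-zero : ∀ N i j → N ≤ i + j → N ∸ i ∸ j ≡ 0
factor-zero N i j le = ∸-+-assoc N i j ∙ m≤n⇒m∸n≡0 le

-- Beyond the support of c the factor N ∸ i ∸ j of the recurrence vanishes.
recurrence-bounded : ∀ {c} k → Bounded c k → Bounded (recurrence (suc (suc k)) c) (suc k)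
recurrence-bounded {c} k bd i j lt
  rewrite bounded-weaken k bd i j lt | shiftSeg-bounded k bd i j lt | factor-zero (suc (suc k)) i j lt
  = +-identityʳ _ ∙ *-zeroʳ (i + j + 1)

shiftDesSeg-zero : ∀ c i → shiftDes (shiftSeg c) i 0 ≡ 0
shiftDesSeg-zero c zero    = refl
shiftDesSeg-zero c (suc i) = refl

shiftDesSeg-suc : ∀ c i j → shiftDes (shiftSeg c) i (suc j) ≡ shiftDes c i j
shiftDesSeg-suc c zero    j = refl
shiftDesSeg-suc c (suc i) j = refl

shiftSeg-extend : ∀ g c i j →
  shiftSeg (extend g c) i j ≡ (if g then shiftDes (shiftSeg c) i j else shiftSeg c i j) + shiftSeg (shiftSeg c) i j
shiftSeg-extend true  c i zero = sym (cong (_+ 0) (shiftDesSeg-zero c i))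
shiftSeg-extend false c i zero = refl
shiftSeg-extend true  c zero    (suc j) = refl
shiftSeg-extend true  c (suc i) (suc j) = refl
shiftSeg-extend false c i (suc j) = refl

shiftDes-extend : ∀ g c i j →
  shiftDes (extend g c) i j ≡ (if g then shiftDes (shiftDes c) i j else shiftDes c i j) + shiftDes (shiftSeg c) i j
shiftDes-extend true  c zero j = refl
shiftDes-extend false c zero j = refl
shiftDes-extend true  c (suc i) j = refl
shiftDes-extend false c (suc i) j = refl

shiftDesSeg-extend : ∀ g c i j →
  shiftDes (shiftSeg (extend g c)) i j
    ≡ (if g then shiftDes (shiftDes (shiftSeg c)) i j else shiftDes (shiftSeg c) i j) + shiftDes (shiftSeg (shiftSeg c)) i j
shiftDesSeg-extend true  c zero j = refl
shiftDesSeg-extend false c zero j = refl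
shiftDesSeg-extend g c (suc i) j = shiftSeg-extend g c i j

shiftDes-recurrence : ∀ N c i j →
  shiftDes (recurrence N c) i j
    ≡ (i + j) * (shiftDes c i j + shiftDes (shiftSeg c) i j)
      + (suc N ∸ i ∸ j) * (shiftDes (shiftDes c) i j + shiftDes (shiftDes (shiftSeg c)) i j)
shiftDes-recurrence N c zero j = sym (cong₂ _+_ (*-zeroʳ j) (*-zeroʳ (suc N ∸ 0 ∸ j)))
shiftDes-recurrence N c (suc i) j =
  cong (λ x → x * (c i j + shiftSeg c i j) + (N ∸ i ∸ j) * (shiftDes c i j + shiftDes (shiftSeg c) i j))
       (+-comm (i + j) 1)

shiftSeg-recurrence : ∀ N c i j →
  shiftSeg (recurrence N c) i j
    ≡ (i + j) * (shiftSeg c i j + shiftSeg (shiftSeg c) i j)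
      + (suc N ∸ i ∸ j) * (shiftDes (shiftSeg c) i j + shiftDes (shiftSeg (shiftSeg c)) i j)
shiftSeg-recurrence N c i zero rewrite shiftDesSeg-zero c i | shiftDesSeg-zero (shiftSeg c) i =
  sym (cong₂ _+_ (*-zeroʳ (i + 0)) (*-zeroʳ (suc N ∸ i ∸ 0)))
shiftSeg-recurrence N c i (suc j)
  rewrite shiftDesSeg-suc c i j | shiftDesSeg-suc (shiftSeg c) i j | factor-shift N i j | +-suc i j
        | +-comm (i + j) 1 = refl

shiftDes-⊕ : ∀ S T → shiftDes (S ⊕ T) ≐ shiftDes S ⊕ shiftDes T
shiftDes-⊕ S T zero    j = refl
shiftDes-⊕ S T (suc i) j = refl

shiftSeg-⊕ : ∀ S T → shiftSeg (S ⊕ T) ≐ shiftSeg S ⊕ shiftSeg T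
shiftSeg-⊕ S T i zero    = refl
shiftSeg-⊕ S T i (suc j) = refl

extend-⊕ : ∀ g S T → extend g (S ⊕ T) ≐ extend g S ⊕ extend g T
extend-⊕ true S T i j =
  cong₂ _+_ (shiftDes-⊕ S T i j) (shiftSeg-⊕ S T i j)
  ∙ +-interchange (shiftDes S i j) (shiftDes T i j) (shiftSeg S i j) (shiftSeg T i j)
extend-⊕ false S T i j =
  cong (S i j + T i j +_) (shiftSeg-⊕ S T i j) ∙ +-interchange (S i j) (T i j) (shiftSeg S i j) (shiftSeg T i j)

extend-comm : ∀ g c → extend true (extend g c) ≐ extend g (extend true c)
extend-comm true  c i j = refl
extend-comm false c i j =
  cong₂ _+_ (shiftDes-extend false c i j) (shiftSeg-extend false c i j)
  ∙ +-interchange (shiftDes c i j) (shiftDes (shiftSeg c) i j) (shiftSeg c i j) (shiftSeg (shiftSeg c) i j)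
  ∙ sym (cong (extend true c i j +_) (shiftSeg-extend true c i j))

sumTable : (A → Table) → List A → Table
sumTable h xs i j = sumBy (λ u → h u i j) xs

module _ (h : A → Table) (xs : List A) where

  shiftDes-sumTable : ∀ i j → shiftDes (sumTable h xs) i j ≡ sumBy (λ u → shiftDes (h u) i j) xs
  shiftDes-sumTable zero    j = sym (sumBy-zero xs)
  shiftDes-sumTable (suc i) j = refl

  shiftSeg-sumTable : ∀ i j → shiftSeg (sumTable h xs) i j ≡ sumBy (λ u → shiftSeg (h u) i j) xs
  shiftSeg-sumTable i zero    = sym (sumBy-zero xs)
  shiftSeg-sumTable i (suc j) = refl

  shiftDesSeg-sumTable : ∀ i j →
    shiftDes (shiftSeg (sumTable h xs)) i j ≡ sumBy (λ u → shiftDes (shiftSeg (h u)) i j) xs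
  shiftDesSeg-sumTable zero    j = sym (sumBy-zero xs)
  shiftDesSeg-sumTable (suc i) j = shiftSeg-sumTable i j

  extend-sumTable : ∀ g i j → extend g (sumTable h xs) i j ≡ sumBy (λ u → extend g (h u) i j) xs
  extend-sumTable true i j =
    cong₂ _+_ (shiftDes-sumTable i j) (shiftSeg-sumTable i j)
    ∙ sym (sumBy-+ (λ u → shiftDes (h u) i j) (λ u → shiftSeg (h u) i j) xs)
  extend-sumTable false i j =
    cong (sumTable h xs i j +_) (shiftSeg-sumTable i j)
    ∙ sym (sumBy-+ (λ u → h u i j) (λ u → shiftSeg (h u) i j) xs)

  recurrence-sumTable : ∀ N i j → recurrence N (sumTable h xs) i j ≡ sumBy (λ u → recurrence N (h u) i j) xs
  recurrence-sumTable N i j =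
    cong₂ _+_
      (cong ((i + j + 1) *_) (cong (sumTable h xs i j +_) (shiftSeg-sumTable i j)
                              ∙ sym (sumBy-+ (λ u → h u i j) (λ u → shiftSeg (h u) i j) xs))
       ∙ sym (sumBy-* (i + j + 1) _ xs))
      (cong ((N ∸ i ∸ j) *_) (cong₂ _+_ (shiftDes-sumTable i j) (shiftDesSeg-sumTable i j)
                              ∙ sym (sumBy-+ (λ u → shiftDes (h u) i j) (λ u → shiftDes (shiftSeg (h u)) i j) xs))
       ∙ sym (sumBy-* (N ∸ i ∸ j) _ xs))
    ∙ sym (sumBy-+ _ _ xs)

  SegRecurrence-sumTable : ∀ k → All (λ u → SegRecurrence (h u) k) xs → SegRecurrence (sumTable h xs) k
  SegRecurrence-sumTable k recs i j =
    sym (sumBy-* j (λ u → h u i j) xs)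
    ∙ sumBy-congᴬ xs (All.map (λ rec → rec i j) recs)
    ∙ sumBy-+ _ _ xs
    ∙ cong₂ _+_ (sumBy-* (suc k ∸ i ∸ j) (λ u → shiftSeg (h u) i j) xs
                 ∙ cong ((suc k ∸ i ∸ j) *_) (sym (shiftSeg-sumTable i j)))
                (sumBy-* (suc i) (λ u → shiftSeg (h u) (suc i) j) xs
                 ∙ cong (suc i *_) (sym (shiftSeg-sumTable (suc i) j)))

-- The key operator identity behind the first recurrence, where the factor
-- N ∸ i ∸ j is not truncated: a polynomial identity in the entries of c.
recurrence-extend-within : ∀ g c N i j → i + j ≤ N →
  recurrence (suc N) (extend g c) i j ≡ extend false (extend true c) i j + extend g (recurrence N c) i j
recurrence-extend-within g c N i j i+j≤N = expand g
  where
  m = N ∸ i ∸ j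
  s = i + j
  -- cXY is c shifted X times in the descent and Y times in the segmentation index.
  c00 = c i j ; c01 = shiftSeg c i j ; c02 = shiftSeg (shiftSeg c) i j
  c10 = shiftDes c i j ; c11 = shiftDes (shiftSeg c) i j ; c12 = shiftDes (shiftSeg (shiftSeg c)) i j
  c20 = shiftDes (shiftDes c) i j ; c21 = shiftDes (shiftDes (shiftSeg c)) i j
  factor : suc N ∸ i ∸ j ≡ suc m
  factor = factor-suc N i j i+j≤N
  expand : ∀ g → recurrence (suc N) (extend g c) i j ≡ extend false (extend true c) i j + extend g (recurrence N c) i j
  expand true =
    cong₂ _+_ (cong (λ x → (s + 1) * ((c10 + c01) + x)) (shiftSeg-extend true c i j))
              (cong₂ _*_ factor (cong₂ _+_ (shiftDes-extend true c i j) (shiftDesSeg-extend true c i j)))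
    ∙ polynomial s m c00 c01 c02 c10 c11 c12 c20 c21
    ∙ sym (cong₂ _+_ (cong ((c10 + c01) +_) (shiftSeg-extend true c i j))
                     (cong₂ _+_ (shiftDes-recurrence N c i j ∙ cong (λ x → s * (c10 + c11) + x * (c20 + c21)) factor)
                                (shiftSeg-recurrence N c i j ∙ cong (λ x → s * (c01 + c02) + x * (c11 + c12)) factor)))
    where
    polynomial : ∀ s m c00 c01 c02 c10 c11 c12 c20 c21 →
      (s + 1) * ((c10 + c01) + (c11 + c02)) + suc m * ((c20 + c11) + (c21 + c12))
      ≡ (c10 + c01) + (c11 + c02) + ((s * (c10 + c11) + suc m * (c20 + c21)) + (s * (c01 + c02) + suc m * (c11 + c12)))
    polynomial = solve-∀
  expand false =
    cong₂ _+_ (cong (λ x → (s + 1) * ((c00 + c01) + x)) (shiftSeg-extend false c i j))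
              (cong₂ _*_ factor (cong₂ _+_ (shiftDes-extend false c i j) (shiftDesSeg-extend false c i j)))
    ∙ polynomial s m c00 c01 c02 c10 c11 c12
    ∙ sym (cong₂ _+_ (cong ((c10 + c01) +_) (shiftSeg-extend true c i j))
                     (cong (recurrence N c i j +_)
                           (shiftSeg-recurrence N c i j ∙ cong (λ x → s * (c01 + c02) + x * (c11 + c12)) factor)))
    where
    polynomial : ∀ s m c00 c01 c02 c10 c11 c12 →
      (s + 1) * ((c00 + c01) + (c01 + c02)) + suc m * ((c10 + c11) + (c11 + c12))
      ≡ (c10 + c01) + (c11 + c02) + (((s + 1) * (c00 + c01) + m * (c10 + c11)) + (s * (c01 + c02) + suc m * (c11 + c12)))
    polynomial = solve-∀

-- The operator identity itself: inserting the largest letter into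
-- a ∷ b ∷ w, it goes in front of a or between a and b (the first summand),
-- or into b ∷ w, which is then extended by a.  Beyond the support of c
-- both sides vanish.
recurrence-extend : ∀ g c k → Bounded c k →
  recurrence (suc (suc (suc k))) (extend g c)
    ≐ extend false (extend true c) ⊕ extend g (recurrence (suc (suc k)) c)
recurrence-extend g c k bd i j with i + j ≤? suc (suc k)
... | yes i+j≤ = recurrence-extend-within g c (suc (suc k)) i j i+j≤
... | no i+j≰ =
  recurrence-bounded (suc k) (extend-bounded g k bd) i j lt
  ∙ sym (cong₂ _+_ (extend-bounded false (suc k) (extend-bounded true k bd) i j lt)
                   (extend-bounded g (suc k) (recurrence-bounded k bd) i j lt))
  where
  lt = ≰⇒> i+j≰

segRecurrence-extend : ∀ g c k → Bounded c k → SegRecurrence c k → SegRecurrence (extend g c) (suc k)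
segRecurrence-extend g c k bd rec i j = extended g
  where
  F₁ = suc k ∸ i ∸ j
  F₂ = suc (suc k) ∸ i ∸ j
  c00 = c i j ; c01 = shiftSeg c i j ; c02 = shiftSeg (shiftSeg c) i j
  c10 = shiftDes c i j ; c11 = shiftDes (shiftSeg c) i j
  d01 = shiftSeg c (suc i) j ; d02 = shiftSeg (shiftSeg c) (suc i) j
  rec-shiftSeg : ∀ i j → j * shiftSeg c i j
    ≡ shiftSeg c i j + (suc (suc k) ∸ i ∸ j) * shiftSeg (shiftSeg c) i j + suc i * shiftSeg (shiftSeg c) (suc i) j
  rec-shiftSeg i zero = sym (cong₂ _+_ (*-zeroʳ (suc (suc k) ∸ i ∸ 0)) (*-zeroʳ (suc i)))
  rec-shiftSeg i (suc j) rewrite factor-shift (suc k) i j = cong (c i j +_) (rec i j) ∙ sym (+-assoc (c i j) _ _)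
  rec-shiftDes : ∀ i j → j * shiftDes c i j ≡ (suc (suc k) ∸ i ∸ j) * shiftDes (shiftSeg c) i j + i * shiftSeg c i j
  rec-shiftDes zero j = *-zeroʳ j ∙ sym (+-identityʳ _ ∙ *-zeroʳ (suc (suc k) ∸ 0 ∸ j))
  rec-shiftDes (suc i) j = rec i j
  -- F₁ * c01 + c01 = F₂ * c01, using boundedness when F₁ is truncated at 0.
  factor-step : F₁ * c01 + c01 ≡ F₂ * c01
  factor-step with i + j ≤? suc k
  ... | yes le rewrite factor-suc (suc k) i j le = +-comm (F₁ * c01) c01
  ... | no nle rewrite shiftSeg-bounded k bd i j (≰⇒> nle) = cong₂ _+_ (*-zeroʳ F₁) refl ∙ sym (*-zeroʳ F₂)
  extended : ∀ g → j * extend g c i j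
    ≡ (suc (suc k) ∸ i ∸ j) * shiftSeg (extend g c) i j + suc i * shiftSeg (extend g c) (suc i) j
  extended false =
    *-distribˡ-+ j c00 c01 ∙ cong₂ _+_ (rec i j) (rec-shiftSeg i j)
    ∙ regroup F₁ F₂ (suc i) c01 c02 d01 d02
    ∙ cong (λ x → x + F₂ * c02 + suc i * (d01 + d02)) factor-step
    ∙ collect F₂ (suc i) c01 c02 d01 d02
    ∙ sym (cong₂ _+_ (cong (F₂ *_) (shiftSeg-extend false c i j)) (cong (suc i *_) (shiftSeg-extend false c (suc i) j)))
    where
    regroup : ∀ F₁ F₂ si c01 c02 d01 d02 →
      (F₁ * c01 + si * d01) + (c01 + F₂ * c02 + si * d02) ≡ (F₁ * c01 + c01) + F₂ * c02 + si * (d01 + d02)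
    regroup = solve-∀
    collect : ∀ F₂ si c01 c02 d01 d02 →
      F₂ * c01 + F₂ * c02 + si * (d01 + d02) ≡ F₂ * (c01 + c02) + si * (d01 + d02)
    collect = solve-∀
  extended true =
    *-distribˡ-+ j c10 c01 ∙ cong₂ _+_ (rec-shiftDes i j) (rec-shiftSeg i j)
    ∙ polynomial F₂ i c11 c01 c02 d02
    ∙ sym (cong₂ _+_ (cong (F₂ *_) (shiftSeg-extend true c i j)) (cong (suc i *_) (shiftSeg-extend true c (suc i) j)))
    where
    polynomial : ∀ F₂ i c11 c01 c02 d02 →
      (F₂ * c11 + i * c01) + (c01 + F₂ * c02 + suc i * d02) ≡ F₂ * (c11 + c02) + suc i * (c01 + d02)
    polynomial = solve-∀

bars : List Bool
bars = true ∷ false ∷ []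

hasDesSeg : List ℕ → ℕ → ℕ → List Bool → Bool
hasDesSeg w i j bs = (desW w bs ≡ᵇ i) ∧ (segB bs ≡ᵇ j)

barTable : ℕ → List ℕ → Table
barTable k w i j = count (hasDesSeg w i j) (words k bars)

K-as-sum : ∀ n i j → K n i j ≡ sumBy (λ w → barTable (n ∸ 1) w i j) (perms n)
K-as-sum n i j =
  count-concatMap _ (λ w → map (w ,_) (words (n ∸ 1) bars)) (perms n)
  ∙ sumBy-cong (λ w → count-map (λ σ → (des σ ≡ᵇ i) ∧ (seg σ ≡ᵇ j)) (w ,_) (words (n ∸ 1) bars)) (perms n)

barred-first-gap : ∀ k a b w i j →
  count (hasDesSeg (a ∷ b ∷ w) i j) (map (true ∷_) (words k bars)) ≡ shiftSeg (barTable k (b ∷ w)) i j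
barred-first-gap k a b w i zero =
  count-map _ (true ∷_) (words k bars)
  ∙ cong length (select-none _ (words k bars) (All.tabulate λ {bs} _ → ∧-zeroʳ (desW (b ∷ w) bs ≡ᵇ i)))
barred-first-gap k a b w i (suc j) = count-map _ (true ∷_) (words k bars)

unbarred-first-gap : ∀ k a b w i j →
  count (hasDesSeg (a ∷ b ∷ w) i j) (map (false ∷_) (words k bars))
    ≡ (if b <ᵇ a then shiftDes (barTable k (b ∷ w)) i j else barTable k (b ∷ w) i j)
unbarred-first-gap k a b w i j = count-map _ (false ∷_) (words k bars) ∙ descent (b <ᵇ a) i
  where
  descent : ∀ g i →
    count (λ bs → ((if g then 1 else 0) + desW (b ∷ w) bs ≡ᵇ i) ∧ (segB bs ≡ᵇ j)) (words k bars)
      ≡ (if g then shiftDes (barTable k (b ∷ w)) i j else barTable k (b ∷ w) i j)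
  descent true  zero    = cong length (select-none _ (words k bars) (All.tabulate λ _ → refl))
  descent true  (suc i) = refl
  descent false i       = refl

barTable-cons : ∀ k a b w → barTable (suc k) (a ∷ b ∷ w) ≐ extend (b <ᵇ a) (barTable k (b ∷ w))
barTable-cons k a b w i j =
  count-++ P (map (true ∷_) W) (map (false ∷_) W ++ [])
  ∙ cong₂ _+_ (barred-first-gap k a b w i j)
              (count-++ P (map (false ∷_) W) [] ∙ +-identityʳ _ ∙ unbarred-first-gap k a b w i j)
  ∙ +-comm (shiftSeg (barTable k (b ∷ w)) i j) _
  where
  P = hasDesSeg (a ∷ b ∷ w) i j
  W = words k bars

barTable-cons-with : ∀ {g} k a b w → (b <ᵇ a) ≡ g → barTable (suc k) (a ∷ b ∷ w) ≐ extend g (barTable k (b ∷ w))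
barTable-cons-with k a b w refl = barTable-cons k a b w

<⇒<ᵇ≡true : ∀ {a m} → a < m → (a <ᵇ m) ≡ true
<⇒<ᵇ≡true a<m = Equivalence.to T-≡ (<⇒<ᵇ a<m)

<⇒>ᵇ≡false : ∀ {a m} → a < m → (m <ᵇ a) ≡ false
<⇒>ᵇ≡false {a} {m} a<m with m <ᵇ a in eq
... | false = refl
... | true  = ⊥-elim (<-asym a<m (<ᵇ⇒< m a (Equivalence.from T-≡ eq)))

-- Each gap contributes at most one descent or segmentation, so bar tables
-- of size k are supported on i + j ≤ k.
segB≤length : ∀ bs → segB bs ≤ length bs
segB≤length []           = z≤n
segB≤length (true ∷ bs)  = s≤s (segB≤length bs)
segB≤length (false ∷ bs) = m≤n⇒m≤1+n (segB≤length bs)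

desW+segB≤length : ∀ w bs → desW w bs + segB bs ≤ length bs
desW+segB≤length (a ∷ b ∷ w) (true ∷ bs)
  rewrite +-suc (desW (b ∷ w) bs) (segB bs) = s≤s (desW+segB≤length (b ∷ w) bs)
desW+segB≤length (a ∷ b ∷ w) (false ∷ bs) with b <ᵇ a
... | true  = s≤s (desW+segB≤length (b ∷ w) bs)
... | false = m≤n⇒m≤1+n (desW+segB≤length (b ∷ w) bs)
desW+segB≤length []          bs = segB≤length bs
desW+segB≤length (a ∷ [])    bs = segB≤length bs
desW+segB≤length (a ∷ b ∷ w) [] = z≤n

barTable-bounded : ∀ k w → Bounded (barTable k w) k
barTable-bounded k w i j k<i+j =
  cong length (select-none _ (words k bars) (All.map excluded (words-length k bars)))
  where
  excluded : ∀ {bs} → length bs ≡ k → hasDesSeg w i j bs ≡ false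
  excluded {bs} len with desW w bs ≡ᵇ i in eq₁ | segB bs ≡ᵇ j in eq₂
  ... | false | _     = refl
  ... | true  | false = refl
  ... | true  | true  = ⊥-elim (<⇒≱ k<i+j (begin
      i + j               ≡⟨ sym (cong₂ _+_ (≡ᵇ⇒≡ (desW w bs) i (Equivalence.from T-≡ eq₁))
                                            (≡ᵇ⇒≡ (segB bs) j (Equivalence.from T-≡ eq₂))) ⟩
      desW w bs + segB bs ≤⟨ desW+segB≤length w bs ⟩
      length bs           ≡⟨ len ⟩
      k                   ∎))
    where open ≤-Reasoning

-- The second identity for a one-letter word, whose only bar table entry
-- is a 1 at (0, 0).
segRecurrence-one-letter : ∀ a → SegRecurrence (barTable 0 (a ∷ [])) 0
segRecurrence-one-letter a zero    zero          = refl
segRecurrence-one-letter a zero    (suc zero)    = refl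
segRecurrence-one-letter a zero    (suc (suc j)) = *-zeroʳ (suc (suc j))
segRecurrence-one-letter a (suc i) zero          = sym (cong₂ _+_ (*-zeroʳ (0 ∸ i)) (*-zeroʳ (suc (suc i))))
segRecurrence-one-letter a (suc i) (suc j)       =
  *-zeroʳ (suc j) ∙ sym (cong₂ _+_ (*-zeroʳ (0 ∸ i ∸ suc j)) (*-zeroʳ (suc (suc i))))

segRecurrence-barTable : ∀ w k → length w ≡ suc k → SegRecurrence (barTable k w) k
segRecurrence-barTable (a ∷ [])    .0 refl = segRecurrence-one-letter a
segRecurrence-barTable (a ∷ b ∷ w) .(suc (length w)) refl =
  SegRecurrence-cong (suc (length w)) (λ i j → sym (barTable-cons (length w) a b w i j))
    (segRecurrence-extend (b <ᵇ a) (barTable (length w) (b ∷ w)) (length w) (barTable-bounded (length w) (b ∷ w))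
      (segRecurrence-barTable (b ∷ w) (length w) refl))

recurrence-one-letter : ∀ a → extend true (barTable 0 (a ∷ [])) ⊕ extend false (barTable 0 (a ∷ []))
                                ≐ recurrence 2 (barTable 0 (a ∷ []))
recurrence-one-letter a i j with i + j ≤? 1
recurrence-one-letter a zero          zero       | yes _ = refl
recurrence-one-letter a zero          (suc zero) | yes _ = refl
recurrence-one-letter a (suc zero)    zero       | yes _ = refl
recurrence-one-letter a zero    (suc (suc j))    | yes (s≤s ())
recurrence-one-letter a (suc zero)    (suc j)    | yes (s≤s ())
recurrence-one-letter a (suc (suc i)) j          | yes (s≤s ())
... | no i+j≰1 =
  cong₂ _+_ (extend-bounded true 0 (barTable-bounded 0 (a ∷ [])) i j (≰⇒> i+j≰1))
            (extend-bounded false 0 (barTable-bounded 0 (a ∷ [])) i j (≰⇒> i+j≰1))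
  ∙ sym (recurrence-bounded 0 (barTable-bounded 0 (a ∷ [])) i j (≰⇒> i+j≰1))

insertion-one-letter : ∀ a m → a < m →
  sumTable (barTable 1) (insertions m (a ∷ [])) ≐ recurrence 2 (barTable 0 (a ∷ []))
insertion-one-letter a m a<m i j =
  cong₂ _+_ (barTable-cons-with 0 m a [] (<⇒<ᵇ≡true a<m) i j)
            (+-identityʳ _ ∙ barTable-cons-with 0 a m [] (<⇒>ᵇ≡false a<m) i j)
  ∙ recurrence-one-letter a i j

-- Inserting m in front of a gives extend true, and
-- between a and b gives extend false after extend true; inserting it later
-- is extending by a an insertion into b ∷ w.
insertion-step : ∀ k a b w m → a < m → b < m →
  sumTable (barTable (suc k)) (insertions m (b ∷ w)) ≐ recurrence (suc (suc k)) (barTable k (b ∷ w)) →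
  sumTable (barTable (suc (suc k))) (insertions m (a ∷ b ∷ w))
    ≐ recurrence (suc (suc (suc k))) (barTable (suc k) (a ∷ b ∷ w))
insertion-step k a b w m a<m b<m hyp i j = begin
  sumTable (barTable (suc (suc k))) (insertions m (a ∷ b ∷ w)) i j
    ≡⟨ cong (barTable (suc (suc k)) (m ∷ a ∷ b ∷ w) i j +_)
            (sumBy-map (λ v → barTable (suc (suc k)) v i j) (a ∷_) (insertions m (b ∷ w))
             ∙ cong (barTable (suc (suc k)) (a ∷ m ∷ b ∷ w) i j +_)
                    (sumBy-map (λ v → barTable (suc (suc k)) (a ∷ v) i j) (b ∷_) (insertions m w))) ⟩
  barTable (suc (suc k)) (m ∷ a ∷ b ∷ w) i j
    + (barTable (suc (suc k)) (a ∷ m ∷ b ∷ w) i j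
       + sumBy (λ u → barTable (suc (suc k)) (a ∷ b ∷ u) i j) (insertions m w))
    ≡⟨ cong₂ _+_ m-first (cong₂ _+_ m-second m-later) ⟩
  extend true (extend g c) i j + (extend false (extend true c) i j + extend g S i j)
    ≡⟨ cong (_+ (extend false (extend true c) i j + extend g S i j)) (extend-comm g c i j) ⟩
  extend g (extend true c) i j + (extend false (extend true c) i j + extend g S i j)
    ≡⟨ +-exchange (extend g (extend true c) i j) (extend false (extend true c) i j) (extend g S i j) ⟩
  extend false (extend true c) i j + (extend g (extend true c) i j + extend g S i j)
    ≡⟨ cong (extend false (extend true c) i j +_)
            (sym (extend-⊕ g (extend true c) S i j) ∙ extend-cong g hyp′ i j) ⟩
  extend false (extend true c) i j + extend g (recurrence (suc (suc k)) c) i j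
    ≡⟨ sym (recurrence-extend g c k (barTable-bounded k (b ∷ w)) i j) ⟩
  recurrence (suc (suc (suc k))) (extend g c) i j
    ≡⟨ sym (recurrence-cong (suc (suc (suc k))) (barTable-cons k a b w) i j) ⟩
  recurrence (suc (suc (suc k))) (barTable (suc k) (a ∷ b ∷ w)) i j ∎
  where
  open ≡-Reasoning
  g = b <ᵇ a
  c = barTable k (b ∷ w)
  -- insertions of m into b ∷ w after b
  S : Table
  S = sumTable (λ u → barTable (suc k) (b ∷ u)) (insertions m w)
  m-before-b : barTable (suc k) (m ∷ b ∷ w) ≐ extend true c
  m-before-b = barTable-cons-with k m b w (<⇒<ᵇ≡true b<m)
  m-first : barTable (suc (suc k)) (m ∷ a ∷ b ∷ w) i j ≡ extend true (extend g c) i j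
  m-first = barTable-cons-with (suc k) m a (b ∷ w) (<⇒<ᵇ≡true a<m) i j
          ∙ extend-cong true (barTable-cons k a b w) i j
  m-second : barTable (suc (suc k)) (a ∷ m ∷ b ∷ w) i j ≡ extend false (extend true c) i j
  m-second = barTable-cons-with (suc k) a m (b ∷ w) (<⇒>ᵇ≡false a<m) i j ∙ extend-cong false m-before-b i j
  m-later : sumBy (λ u → barTable (suc (suc k)) (a ∷ b ∷ u) i j) (insertions m w) ≡ extend g S i j
  m-later = sumBy-cong (λ u → barTable-cons (suc k) a b u i j) (insertions m w)
          ∙ sym (extend-sumTable (λ u → barTable (suc k) (b ∷ u)) (insertions m w) g i j)
  hyp′ : extend true c ⊕ S ≐ recurrence (suc (suc k)) c
  hyp′ i j =
    cong₂ _+_ (sym (m-before-b i j)) (sym (sumBy-map (λ v → barTable (suc k) v i j) (b ∷_) (insertions m w)))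
    ∙ hyp i j

insertion-recurrence : ∀ w k m → length w ≡ suc k → All (_< m) w →
  sumTable (barTable (suc k)) (insertions m w) ≐ recurrence (suc (suc k)) (barTable k w)
insertion-recurrence (a ∷ [])    .0 m refl (a<m ∷ []) = insertion-one-letter a m a<m
insertion-recurrence (a ∷ b ∷ w) .(suc (length w)) m refl (a<m ∷ b<m ∷ w<m) =
  insertion-step (length w) a b w m a<m b<m (insertion-recurrence (b ∷ w) (length w) m refl (b<m ∷ w<m))

All-perms : {P : List ℕ → Set} (n : ℕ) → (∀ w → length w ≡ n → All (_< suc n) w → P w) → All P (perms n)
All-perms n f = All.tabulate λ {w} w∈perms →
  f w (All.lookup (perms-length n) w∈perms) (All.lookup (perms-bounded n) w∈perms)

K-recurrence : ∀ n → K (suc (suc n)) ≐ recurrence (suc (suc n)) (K (suc n))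
K-recurrence n i j = begin
  K (suc (suc n)) i j
    ≡⟨ K-as-sum (suc (suc n)) i j ⟩
  sumBy (λ v → barTable (suc n) v i j) (perms (suc (suc n)))
    ≡⟨ sumBy-perms-suc (suc n) (λ v → barTable (suc n) v i j) ⟩
  sumBy (λ w → sumTable (barTable (suc n)) (insertions (suc (suc n)) w) i j) (perms (suc n))
    ≡⟨ sumBy-congᴬ (perms (suc n))
         (All-perms (suc n) λ w len w<m → insertion-recurrence w n (suc (suc n)) len w<m i j) ⟩
  sumBy (λ w → recurrence (suc (suc n)) (barTable n w) i j) (perms (suc n))
    ≡⟨ sym (recurrence-sumTable (barTable n) (perms (suc n)) (suc (suc n)) i j) ⟩
  recurrence (suc (suc n)) (sumTable (barTable n) (perms (suc n))) i j
    ≡⟨ recurrence-cong (suc (suc n)) (λ i j → sym (K-as-sum (suc n) i j)) i j ⟩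
  recurrence (suc (suc n)) (K (suc n)) i j ∎
  where open ≡-Reasoning

K-segRecurrence : ∀ n → SegRecurrence (K (suc n)) n
K-segRecurrence n =
  SegRecurrence-cong n (λ i j → sym (K-as-sum (suc n) i j))
    (SegRecurrence-sumTable (barTable n) (perms (suc n)) n
      (All-perms (suc n) λ w len _ → segRecurrence-barTable w n len))

-- Integer indices: K extended by zero to negative indices.  (Imported only
-- here because its prefix operator +_ would clash with sections (x +_).)
open import Data.Integer using (+_) renaming (_-_ to _-ℤ_)

Kℤ-shiftSeg : ∀ m i j → Kℤ m (+ i) (+ j -ℤ + 1) ≡ shiftSeg (K m) i j
Kℤ-shiftSeg m i zero    = refl
Kℤ-shiftSeg m i (suc j) = refl

Kℤ-shiftDes : ∀ m i j → Kℤ m (+ i -ℤ + 1) (+ j) ≡ shiftDes (K m) i j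
Kℤ-shiftDes m zero    j = refl
Kℤ-shiftDes m (suc i) j = refl

Kℤ-shiftDesSeg : ∀ m i j → Kℤ m (+ i -ℤ + 1) (+ j -ℤ + 1) ≡ shiftDes (shiftSeg (K m)) i j
Kℤ-shiftDesSeg m zero    j       = refl
Kℤ-shiftDesSeg m (suc i) zero    = refl
Kℤ-shiftDesSeg m (suc i) (suc j) = refl

-- The theorem, for n = n′ + 1: the first identity is K-recurrence (for n′ = 0
-- it is the single entry (0, 0)); the second, K-segRecurrence, holds even
-- without the hypothesis 0 < j.
mainTheorem3 : (n i j : ℕ) → 0 < n → i + j < n →
    (K n i j ≡ (i + j + 1) * (Kℤ (n ∸ 1) (+ i) (+ j) + Kℤ (n ∸ 1) (+ i) (+ j -ℤ + 1))
    + (n ∸ i ∸ j) * (Kℤ (n ∸ 1) (+ i -ℤ + 1) (+ j) + Kℤ (n ∸ 1) (+ i -ℤ + 1) (+ j -ℤ + 1)))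
    × (0 < j → j * K n i j ≡ (n ∸ i ∸ j) * Kℤ n (+ i) (+ j -ℤ + 1) + (i + 1) * Kℤ n (+ (i + 1)) (+ j -ℤ + 1))
mainTheorem3 (suc n) i j _ i+j<1+n = first n i j i+j<1+n , λ _ → second
  where
  first : ∀ n i j → i + j < suc n →
    K (suc n) i j ≡ (i + j + 1) * (K n i j + Kℤ n (+ i) (+ j -ℤ + 1))
                    + (suc n ∸ i ∸ j) * (Kℤ n (+ i -ℤ + 1) (+ j) + Kℤ n (+ i -ℤ + 1) (+ j -ℤ + 1))
  first zero    zero    zero    _ = refl
  first zero    zero    (suc j) (s≤s ())
  first zero    (suc i) j       (s≤s ())
  first (suc n) i       j       _ =
    K-recurrence n i j
    ∙ sym (cong₂ _+_ (cong (λ x → (i + j + 1) * (K (suc n) i j + x)) (Kℤ-shiftSeg (suc n) i j))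
                     (cong ((suc (suc n) ∸ i ∸ j) *_)
                           (cong₂ _+_ (Kℤ-shiftDes (suc n) i j) (Kℤ-shiftDesSeg (suc n) i j))))
  second : j * K (suc n) i j
    ≡ (suc n ∸ i ∸ j) * Kℤ (suc n) (+ i) (+ j -ℤ + 1) + (i + 1) * Kℤ (suc n) (+ (i + 1)) (+ j -ℤ + 1)
  second =
    K-segRecurrence n i j
    ∙ sym (cong₂ _+_ (cong ((suc n ∸ i ∸ j) *_) (Kℤ-shiftSeg (suc n) i j))
                     (cong (λ x → x * Kℤ (suc n) (+ x) (+ j -ℤ + 1)) (+-comm i 1)
                      ∙ cong (suc i *_) (Kℤ-shiftSeg (suc n) (suc i) j)))
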